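{- Let $G,H$ be finite digraphs, $\xi\in\mathcal{H}(G,H)$, and let $\mathcal{T}(\xi)$ be the transitive hull of $\mathcal{G}(\xi)$. If $H$ is transitive, then $\mathcal{H}(\mathcal{T}(\xi),H)=\mathcal{H}(\mathcal{G}(\xi),H)$; if $H$ is additionally antisymmetric, then $\mathcal{S}(\mathcal{T}(\xi),H)=\mathcal{S}(\mathcal{G}(\xi),H)$. Furthermore, if $G,H\in\mathfrak{P}'$ where $\mathfrak{P}'=\mathfrak{P}$ or $\mathfrak{P}'=\mathfrak{P}^*$, then $\mathcal{T}(\xi)\in\mathfrak{P}'$.
   Context: A digraph $G=(V(G),A(G))$ has finite non-empty $V(G)$ and $A(G)\subseteq V(G)\times V(G)$. Loops are arcs $vv$, proper arcs $vw$ with $v\ne w$; $G^*$ is $G$ with loops removed. Homomorphisms $\xi:G\to H$ are maps with $\xi(v)\xi(w)\in A(H)$ for $vw\in A(G)$, $\mathcal{H}(G,H)$ their set; strict homomorphisms map proper arcs to proper arcs, $\mathcal{S}(G,H)$ their set. $v,w$ adjacent if $vw$ or $wv$ is an arc. For $X\subseteq V(G)$, $v\in X$, $\gamma_X(v)$ = set of $w\in X$ equal to $v$ or joined to $v$ by a sequence in $X$ of consecutively adjacent vertices; $\Gamma_\xi(v)=\gamma_{\xi^{ -1}(\xi(v))}(v)$. For $\xi\in\mathcal{H}(G,H)$, $\mathcal{G}(\xi)$ is the digraph with vertex set $\{\Gamma_\xi(v): v\in V(G)\}$ and arcs $(\mathfrak{a},\mathfrak{b})$ whenever there are $a\in\mathfrak{a}$,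 $b\in\mathfrak{b}$ with $ab\in A(G)$. The transitive hull of a digraph has the same vertex set and the smallest transitive arc set containing the original arcs. $\mathfrak{P}$ is the class of finite posets (reflexive, antisymmetric, transitive digraphs) and $\mathfrak{P}^*=\{P^*: P\in\mathfrak{P}\}$. -}

module Defs where

open import Data.Nat using (ℕ; _<_)
open import Data.Fin using (Fin)
open import Data.Product using (Σ; ∃; ∃-syntax; _×_; _,_; proj₁; proj₂)
open import Data.Sum using (_⊎_)
open import Relation.Nullary using (¬_)
open import Relation.Binary.PropositionalEquality using (_≡_; _≢_; isEquivalence)
open import Relation.Binary.Structures using (IsEquivalence)
open import Relation.Binary.Construct.Closure.Transitive using (TransClosure)
open import Function.Bundles using (_⇔_; mk⇔; Equivalence)

record Digraph : Set₁ where
  field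
    n    : ℕ
    0<n  : 0 < n
    Arc  : Fin n → Fin n → Set

open Digraph public

V : Digraph → Set
V G = Fin (n G)

-- A finite digraph whose vertices are presented by representatives in
-- Fin n modulo an equivalence _≈_ (vertex equality).  Needed because the
-- vertices of 𝒢(ξ) are sets Γ_ξ(v), and there are no quotient types.

record SDigraph : Set₁ where
  field
    size  : ℕ
    Arcₛ  : Fin size → Fin size → Set
    _≈_   : Fin size → Fin size → Set
    ≈-equiv : IsEquivalence _≈_

open SDigraph public

plain : Digraph → SDigraph
plain G = record { size = n G ; Arcₛ = Arc G ; _≈_ = _≡_ ; ≈-equiv = isEquivalence }

IsHom : (S : SDigraph) (H : Digraph) → (Fin (size S) → V H) → Set
IsHom S H φ =
  (∀ a b → _≈_ S a b → φ a ≡ φ b) ×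
  (∀ a b → Arcₛ S a b → Arc H (φ a) (φ b))

IsStrict : (S : SDigraph) (H : Digraph) → (Fin (size S) → V H) → Set
IsStrict S H φ =
  IsHom S H φ ×
  (∀ a b → Arcₛ S a b → ¬ (_≈_ S a b) → φ a ≢ φ b)

IsReflexive IsAntisymmetric IsTransitive IsPoset : SDigraph → Set
IsReflexive S = ∀ a → Arcₛ S a a
IsAntisymmetric S = ∀ a b → Arcₛ S a b → Arcₛ S b a → _≈_ S a b
IsTransitive S = ∀ a b c → Arcₛ S a b → Arcₛ S b c → Arcₛ S a c
IsPoset S = IsReflexive S × IsAntisymmetric S × IsTransitive S

InP : SDigraph → Set
InP = IsPoset

-- S ∈ 𝔓* : S = P* for a poset P on the same vertex set
-- (P a well-defined relation on vertices; S's arcs are exactly the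
-- proper arcs of P).
InPStar : SDigraph → Set₁
InPStar S =
  Σ (Fin (size S) → Fin (size S) → Set) λ P →
    (∀ a a′ b b′ → _≈_ S a a′ → _≈_ S b b′ → P a b → P a′ b′) ×
    IsPoset (record S { Arcₛ = P }) ×
    (∀ a b → Arcₛ S a b ⇔ (P a b × ¬ (_≈_ S a b)))

module _ (G : Digraph) {m : ℕ} (ξ : V G → Fin m) where

  Adj : V G → V G → Set
  Adj u w = Arc G u w ⊎ Arc G w u

  -- InΓ v w  :⇔  w ∈ Γ_ξ(v) = γ_{ξ⁻¹(ξ v)}(v)
  -- (w = v, or w joined to v by a sequence of consecutively adjacent
  --  vertices, all lying in the fibre ξ⁻¹(ξ v))
  data InΓ (v : V G) : V G → Set where
    here : InΓ v v
    step : ∀ {u w} → InΓ v u → Adj u w → ξ w ≡ ξ v → InΓ v w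

  SameΓ : V G → V G → Set
  SameΓ v v′ = ∀ w → InΓ v w ⇔ InΓ v′ w

  SameΓ-equiv : IsEquivalence SameΓ
  SameΓ-equiv = record
    { refl  = λ w → mk⇔ (λ x → x) (λ x → x)
    ; sym   = λ p w → mk⇔ (Equivalence.from (p w)) (Equivalence.to (p w))
    ; trans = λ p q w → mk⇔ (λ x → Equivalence.to (q w) (Equivalence.to (p w) x))
                            (λ x → Equivalence.from (p w) (Equivalence.from (q w) x))
    }

  𝒢Arc : V G → V G → Set
  𝒢Arc v w = ∃[ a ] ∃[ b ] (InΓ v a × InΓ w b × Arc G a b)

  𝒢 : SDigraph
  𝒢 = record { size = n G ; Arcₛ = 𝒢Arc ; _≈_ = SameΓ ; ≈-equiv = SameΓ-equiv }

  𝒯 : SDigraph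
  𝒯 = record 𝒢 { Arcₛ = TransClosure 𝒢Arc }

-- A homomorphism into a transitive digraph extends along walks, so
-- 𝒢(ξ) and its transitive hull have the same homomorphisms into H. If H is
-- moreover antisymmetric, a walk in 𝒢(ξ) whose image under a homomorphism
-- returns to its start stays inside one fibre; for a strict φ each step then
-- stays inside one component Γ, and for φ = ξ the steps join components of a
-- common fibre, hence equal components: this is antisymmetry of 𝒯(ξ). When
-- H ∈ 𝔓*, H is loopless and transitive, so 𝒯(ξ) is a strict order and thus
-- the P* of its reflexive closure.

module Submission where

open import Defs
open import Data.Product using (_×_; _,_; proj₁; proj₂)
open import Data.Nat using (ℕ)
open import Data.Fin using (Fin)
open import Data.Sum using (_⊎_; inj₁; inj₂)
open import Data.Empty using (⊥-elim)
open import Function.Base using (id)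
open import Function.Bundles using (_⇔_; mk⇔; Equivalence)
open import Level using (Level)
open import Relation.Nullary using (¬_)
open import Relation.Binary.Core using (Rel; _⇒_; _=[_]⇒_)
open import Relation.Binary.Definitions
  using (Transitive; Antisymmetric; Irreflexive; _Respects₂_)
open import Relation.Binary.Structures using (IsEquivalence)
open import Relation.Binary.PropositionalEquality
  using (_≡_; _≢_; refl; sym; trans; subst; subst₂)
open import Relation.Binary.Construct.Closure.Transitive
  using (TransClosure; [_]; _∷_; _++_)

private
  variable
    a b ℓ ℓ′ : Level
    A : Set a
    B : Set b

Fibrewise : (A → B) → Rel A ℓ → Rel A _
Fibrewise f _R_ x y = x R y × f x ≡ f y

module _ {_R_ : Rel A ℓ} {_T_ : Rel B ℓ′} (f : A → B)
         (T-trans : Transitive _T_) (hom : _R_ =[ f ]⇒ _T_) where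

  lift⁺ : TransClosure _R_ =[ f ]⇒ _T_
  lift⁺ [ r ]    = hom r
  lift⁺ (r ∷ rs) = T-trans (hom r) (lift⁺ rs)

  cycle⇒fibrewise⁺ : Antisymmetric _≡_ _T_ → ∀ {x y} →
                     TransClosure _R_ x y → f y T f x →
                     TransClosure (Fibrewise f _R_) x y
  cycle⇒fibrewise⁺ antisym [ r ]    back = [ r , antisym (hom r) back ]
  cycle⇒fibrewise⁺ antisym (r ∷ rs) back =
    (r , antisym (hom r) (T-trans (lift⁺ rs) back))
    ∷ cycle⇒fibrewise⁺ antisym rs (T-trans back (hom r))

strictOrder⇒InPStar : (S : SDigraph) →
                      Arcₛ S Respects₂ _≈_ S → Transitive (Arcₛ S) →
                      Irreflexive (_≈_ S) (Arcₛ S) → InPStar S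
strictOrder⇒InPStar S (respʳ , respˡ) <-trans <-irrefl =
  _≤_ , ≤-resp , (≤-refl , ≤-antisym , ≤-trans) ,
  λ _ _ → mk⇔ (λ p → inj₁ p , <⇒≄ p) ≤∧≄⇒<
  where
  _≃_ = _≈_ S
  open IsEquivalence (≈-equiv S) renaming (refl to ≃-refl; sym to ≃-sym; trans to ≃-trans)
  _<_ = Arcₛ S

  _≤_ : Rel (Fin (size S)) _
  x ≤ y = x < y ⊎ x ≃ y

  <⇒≄ : ∀ {x y} → x < y → ¬ x ≃ y
  <⇒≄ p e = <-irrefl e p

  ≤-resp : ∀ x x′ y y′ → x ≃ x′ → y ≃ y′ → x ≤ y → x′ ≤ y′
  ≤-resp _ _ _ _ s t (inj₁ p) = inj₁ (respʳ t (respˡ s p))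
  ≤-resp _ _ _ _ s t (inj₂ e) = inj₂ (≃-trans (≃-sym s) (≃-trans e t))

  ≤-refl : ∀ x → x ≤ x
  ≤-refl _ = inj₂ ≃-refl

  ≤-antisym : ∀ x y → x ≤ y → y ≤ x → x ≃ y
  ≤-antisym _ _ (inj₁ p) (inj₁ q) = ⊥-elim (<-irrefl ≃-refl (<-trans p q))
  ≤-antisym _ _ (inj₁ _) (inj₂ e) = ≃-sym e
  ≤-antisym _ _ (inj₂ e) _        = e

  ≤-trans : ∀ x y z → x ≤ y → y ≤ z → x ≤ z
  ≤-trans _ _ _ (inj₁ p) (inj₁ q) = inj₁ (<-trans p q)
  ≤-trans _ _ _ (inj₁ p) (inj₂ e) = inj₁ (respʳ e p)
  ≤-trans _ _ _ (inj₂ e) (inj₁ q) = inj₁ (respˡ (≃-sym e) q)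
  ≤-trans _ _ _ (inj₂ d) (inj₂ e) = inj₂ (≃-trans d e)

  ≤∧≄⇒< : ∀ {x y} → x ≤ y × ¬ x ≃ y → x < y
  ≤∧≄⇒< (inj₁ p , _)  = p
  ≤∧≄⇒< (inj₂ e , ne) = ⊥-elim (ne e)

InPStar⇒loopless : (H : Digraph) → InPStar (plain H) → ∀ x → ¬ Arc H x x
InPStar⇒loopless H (_ , _ , _ , arc⇔) x xx = proj₂ (Equivalence.to (arc⇔ x x) xx) refl

InPStar⇒transitive : (H : Digraph) → InPStar (plain H) → IsTransitive (plain H)
InPStar⇒transitive H (P , _ , (_ , P-antisym , P-trans) , arc⇔) x y z xy yz
  with Equivalence.to (arc⇔ x y) xy | Equivalence.to (arc⇔ y z) yz
... | Pxy , _ | Pyz , y≢z = Equivalence.from (arc⇔ x z) (P-trans x y z Pxy Pyz , x≢z)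
  where
  x≢z : x ≢ z
  x≢z refl = y≢z (P-antisym y x Pyz Pxy)

module _ (G : Digraph) {m : ℕ} (ξ : V G → Fin m) where

  InΓ-fibre : ∀ {v w} → InΓ G ξ v w → ξ w ≡ ξ v
  InΓ-fibre here         = refl
  InΓ-fibre (step _ _ e) = e

  InΓ-trans : Transitive (InΓ G ξ)
  InΓ-trans p here          = p
  InΓ-trans p (step q uw e) = step (InΓ-trans p q) uw (trans e (InΓ-fibre p))

  Adj-sym : ∀ {u w} → Adj G ξ u w → Adj G ξ w u
  Adj-sym (inj₁ uw) = inj₂ uw
  Adj-sym (inj₂ wu) = inj₁ wu

  InΓ-sym : ∀ {v w} → InΓ G ξ v w → InΓ G ξ w v
  InΓ-sym here          = here
  InΓ-sym (step p uw e) =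
    InΓ-trans (step here (Adj-sym uw) (trans (InΓ-fibre p) (sym e))) (InΓ-sym p)

  InΓ⇒SameΓ : ∀ {v w} → InΓ G ξ v w → SameΓ G ξ v w
  InΓ⇒SameΓ p u = mk⇔ (InΓ-trans (InΓ-sym p)) (InΓ-trans p)

  SameΓ⇒InΓ : ∀ {v w} → SameΓ G ξ v w → InΓ G ξ v w
  SameΓ⇒InΓ s = Equivalence.from (s _) here

  𝒢Arc-fibre⇒InΓ : Fibrewise ξ (𝒢Arc G ξ) ⇒ InΓ G ξ
  𝒢Arc-fibre⇒InΓ ((x , y , vx , wy , xy) , e) =
    InΓ-trans vx (InΓ-trans (step here (inj₁ xy) ξy≡ξx) (InΓ-sym wy))
    where
    ξy≡ξx = trans (InΓ-fibre wy) (trans (sym e) (sym (InΓ-fibre vx)))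

  𝒢Arc-resp : 𝒢Arc G ξ Respects₂ SameΓ G ξ
  𝒢Arc-resp = (λ { t (x , y , vx , wy , xy) → x , y , vx , Equivalence.to (t y) wy , xy })
            , (λ { s (x , y , vx , wy , xy) → x , y , Equivalence.to (s x) vx , wy , xy })

  𝒯Arc-resp : TransClosure (𝒢Arc G ξ) Respects₂ SameΓ G ξ
  𝒯Arc-resp = respʳ , respˡ
    where
    respʳ : ∀ {x y y′} → SameΓ G ξ y y′ →
            TransClosure (𝒢Arc G ξ) x y → TransClosure (𝒢Arc G ξ) x y′
    respʳ t [ g ]    = [ proj₁ 𝒢Arc-resp t g ]
    respʳ t (g ∷ gs) = g ∷ respʳ t gs
    respˡ : ∀ {x x′ y} → SameΓ G ξ x x′ →
            TransClosure (𝒢Arc G ξ) x y → TransClosure (𝒢Arc G ξ) x′ y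
    respˡ s [ g ]    = [ proj₂ 𝒢Arc-resp s g ]
    respˡ s (g ∷ gs) = proj₂ 𝒢Arc-resp s g ∷ gs

module _ (G : Digraph) {m : ℕ} (ξ : V G → Fin m)
         (H : Digraph) (H-trans : IsTransitive (plain H)) where
  private
    H-trans′ : Transitive (Arc H)
    H-trans′ = H-trans _ _ _

  𝒯-hom⇔𝒢-hom : ∀ φ → IsHom (𝒯 G ξ) H φ ⇔ IsHom (𝒢 G ξ) H φ
  𝒯-hom⇔𝒢-hom φ = mk⇔ (λ (resp , hom) → resp , λ x y g → hom x y [ g ])
                      (λ (resp , hom) → resp , λ _ _ →
                        lift⁺ {_T_ = Arc H} φ H-trans′ (λ {x y} → hom x y))

  -- φ v ≡ φ w closes the φ-image of a walk from v to w into a cycle, so every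
  -- step lies in a fibre of φ, where strictness forbids leaving Γ.
  𝒯-strict⇔𝒢-strict : IsAntisymmetric (plain H) →
                      ∀ φ → IsStrict (𝒯 G ξ) H φ ⇔ IsStrict (𝒢 G ξ) H φ
  𝒯-strict⇔𝒢-strict H-antisym φ =
    mk⇔ (λ (hom , strict) →
           Equivalence.to (𝒯-hom⇔𝒢-hom φ) hom , λ x y g → strict x y [ g ])
        (λ (hom , strict) →
           Equivalence.from (𝒯-hom⇔𝒢-hom φ) hom , λ _ _ → strict⁺ hom strict)
    where
    open IsEquivalence (SameΓ-equiv G ξ) using () renaming (trans to SameΓ-trans)

    ¬¬SameΓ-trans : Transitive (λ v w → ¬ ¬ SameΓ G ξ v w)
    ¬¬SameΓ-trans ¬¬uv ¬¬vw ¬uw = ¬¬uv (λ uv → ¬¬vw (λ vw → ¬uw (SameΓ-trans uv vw)))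

    strict⁺ : IsHom (𝒢 G ξ) H φ →
              (∀ x y → 𝒢Arc G ξ x y → ¬ SameΓ G ξ x y → φ x ≢ φ y) →
              ∀ {x y} → TransClosure (𝒢Arc G ξ) x y → ¬ SameΓ G ξ x y → φ x ≢ φ y
    strict⁺ (_ , hom) strict gs ¬xy φx≡φy =
      lift⁺ id ¬¬SameΓ-trans fibre-step
        (cycle⇒fibrewise⁺ φ H-trans′ (λ {x y} → hom x y) H-antisym′ gs back) ¬xy
      where
      H-antisym′ : Antisymmetric _≡_ (Arc H)
      H-antisym′ = H-antisym _ _
      back = subst₂ (Arc H) φx≡φy (sym φx≡φy)
               (lift⁺ {_T_ = Arc H} φ H-trans′ (λ {x y} → hom x y) gs)

      fibre-step : Fibrewise φ (𝒢Arc G ξ) ⇒ (λ v w → ¬ ¬ SameΓ G ξ v w)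
      fibre-step (g , e) ¬vw = strict _ _ g ¬vw e

module _ (G H : Digraph) (ξ : V G → V H) (ξ-hom : IsHom (plain G) H ξ)
         (H-trans : IsTransitive (plain H)) where
  private
    H-trans′ : Transitive (Arc H)
    H-trans′ = H-trans _ _ _

  𝒢Arc-hom : 𝒢Arc G ξ =[ ξ ]⇒ Arc H
  𝒢Arc-hom (x , y , vx , wy , xy) =
    subst₂ (Arc H) (InΓ-fibre G ξ vx) (InΓ-fibre G ξ wy) (proj₂ ξ-hom x y xy)

  𝒯Arc-hom : TransClosure (𝒢Arc G ξ) =[ ξ ]⇒ Arc H
  𝒯Arc-hom = lift⁺ {_T_ = Arc H} ξ H-trans′ 𝒢Arc-hom

  𝒯Arc-cycle⇒SameΓ : IsAntisymmetric (plain H) → ∀ {v w} →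
                     TransClosure (𝒢Arc G ξ) v w → Arc H (ξ w) (ξ v) → SameΓ G ξ v w
  𝒯Arc-cycle⇒SameΓ H-antisym gs back =
    InΓ⇒SameΓ G ξ (lift⁺ id (InΓ-trans G ξ) (𝒢Arc-fibre⇒InΓ G ξ)
      (cycle⇒fibrewise⁺ ξ H-trans′ 𝒢Arc-hom (H-antisym _ _) gs back))

  𝒯Arc-irreflexive : (∀ x → ¬ Arc H x x) →
                     Irreflexive (SameΓ G ξ) (TransClosure (𝒢Arc G ξ))
  𝒯Arc-irreflexive loopless {v} {w} s gs =
    loopless (ξ w) (subst (λ z → Arc H z (ξ w)) ξv≡ξw (𝒯Arc-hom gs))
    where
    ξv≡ξw = sym (InΓ-fibre G ξ (SameΓ⇒InΓ G ξ s))

  𝒯-isPoset : IsReflexive (plain G) → IsAntisymmetric (plain H) → IsPoset (𝒯 G ξ)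
  𝒯-isPoset G-refl H-antisym =
      (λ v → [ v , v , here , here , G-refl v ])
    , (λ v w gs hs → 𝒯Arc-cycle⇒SameΓ H-antisym gs (𝒯Arc-hom hs))
    , (λ _ _ _ → _++_)

  𝒯∈𝔓* : (∀ x → ¬ Arc H x x) → InPStar (𝒯 G ξ)
  𝒯∈𝔓* loopless =
    strictOrder⇒InPStar (𝒯 G ξ) (𝒯Arc-resp G ξ) _++_ (𝒯Arc-irreflexive loopless)

proposition1 : (G H : Digraph) (ξ : V G → V H) → IsHom (plain G) H ξ →
    ((IsTransitive (plain H) →
        ∀ (φ : V G → V H) → IsHom (𝒯 G ξ) H φ ⇔ IsHom (𝒢 G ξ) H φ)
    × (IsTransitive (plain H) → IsAntisymmetric (plain H) →
        ∀ (φ : V G → V H) → IsStrict (𝒯 G ξ) H φ ⇔ IsStrict (𝒢 G ξ) H φ)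
    × (InP (plain G) → InP (plain H) → InP (𝒯 G ξ))
    × (InPStar (plain G) → InPStar (plain H) → InPStar (𝒯 G ξ)))
proposition1 G H ξ ξ-hom =
    𝒯-hom⇔𝒢-hom G ξ H
  , 𝒯-strict⇔𝒢-strict G ξ H
  , (λ (G-refl , _) (_ , H-antisym , H-trans) →
       𝒯-isPoset G H ξ ξ-hom H-trans G-refl H-antisym)
  , (λ _ H∈𝔓* →
       𝒯∈𝔓* G H ξ ξ-hom (InPStar⇒transitive H H∈𝔓*) (InPStar⇒loopless H H∈𝔓*))
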